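{- Let $r\in\mathbb{N}$ and let $\mathcal{A}$ and $\mathcal{B}$ be two sets of $\tau$-structures. If there is a separating sentence $\psi$ for $(\mathcal{A},\mathcal{B})$ with $r$ quantifiers such that both $\psi$ and $\neg\psi$ are non-replicating sentences, then Spoiler wins the $r$-round MS game on $(\mathcal{A},\mathcal{B})$ without ever playing on top.
   Context: Fix a schema $\tau$ with finitely many relation and constant symbols. A separating sentence for $(\mathcal{A},\mathcal{B})$ is a first-order sentence true in every structure of $\mathcal{A}$ and false in every structure of $\mathcal{B}$. Atomic formulas: $x_i=x_j$ (distinct variables), $c=x_j$, $c_i=c_j$ (distinct constants), $R(y_1,\dots,y_m)$ with $y$'s variables or constants. A type over distinct variables $x_1,\dots,x_r$ is a conjunction of atomic and negated atomic formulas such that for each atomic formula with variables among $x_1,\dots,x_r$ exactly one of it and its negation is a conjunct; types are taken consistent (satisfiable). Every sentence with $r$ quantifiers is assumed to be of the form $\psi = Q_1x_1\dots Q_rx_r\,\theta$ with each $Q_j\in\{\exists,\forall\}$ and $\theta$ a disjunction of types over $x_1,\dots,x_r$; correspondingly $\neg\psi$ is the sentence $\overline{Q_1}x_1\dots\overline{Q_r}x_r\,\theta'$ with dual quantifiers, where $\theta'$ is the disjunction of the (consistent) types not occurring as disjuncts of $\theta$. A type $t$ occurring as a disjunct of $\theta$ is non-replicating in $\psi$ if (a) whenever an equality $x_i=x_j$ ($i\neq j$) appears in $t$, either both $x_i,x_j$ are universally quantified, or one is universally and the other existentially quantified with the existential quantifier occurring earlier in the prefix (if $Q_i=\exists$,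 $Q_j=\forall$ then $i<j$); and (b) whenever an equality $c=x_j$ with $c$ a constant appears in $t$, $x_j$ is universally quantified. $\psi$ is a non-replicating sentence if every disjunct of $\theta$ is non-replicating in $\psi$. MS game: pebbled structures $\langle\mathbf{A}\mid a_1,\dots,a_t\rangle$ carry pebble $i$ on $a_i$; two form a matching pair if the map $a_i\mapsto b_i$, $c^{\mathbf{A}}\mapsto c^{\mathbf{B}}$ is an isomorphism of the induced substructures on its domain and range. The $r$-round MS game on $(\mathcal{A},\mathcal{B})$ starts at $(\mathcal{A},\mathcal{B})$ (Spoiler wins immediately if no matching pair); in each round $t$ Spoiler picks a side and places pebble $t$ on an element of each pebbled structure there, and Duplicator, for each pebbled structure on the other side, may make any number of copies and places pebble $t$ on an element of each copy; Spoiler wins once no left structure forms a matching pair with a right one; Duplicator wins if a matching pair remains after round $r$. Spoiler plays on top if he places a pebble on an element already carrying a pebble or interpreting a constant symbol. -}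

module Defs where

open import Level using (Level) renaming (suc to lsuc; zero to lzero)
open import Data.Nat using (ℕ; zero; suc)
open import Data.Fin using (Fin; toℕ)
open import Data.Fin as Fin using ()
open import Data.Nat using () renaming (_<_ to _<ℕ_)
open import Data.Bool using (Bool; true; false)
open import Data.Vec using (Vec; []; _∷_; lookup; _∷ʳ_; map)
open import Data.List using (List)
open import Data.List.Relation.Unary.Any using (Any)
open import Data.List.Relation.Unary.All using (All)
open import Data.Product using (Σ; Σ-syntax; _×_; _,_)
open import Data.Sum using (_⊎_; [_,_])
open import Data.Empty using (⊥)
open import Relation.Nullary using (¬_)
open import Relation.Binary.PropositionalEquality using (_≡_; _≢_)

record Schema : Set where
  field
    nRel   : ℕ
    arity  : Fin nRel → ℕ
    nConst : ℕ
open Schema public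

record Structure (τ : Schema) : Set₁ where
  field
    Carrier : Set
    rel     : (R : Fin (nRel τ)) → (Fin (arity τ R) → Carrier) → Set
    const   : Fin (nConst τ) → Carrier
open Structure public

record StructSet (τ : Schema) : Set₁ where
  field
    Idx : Set
    str : Idx → Structure τ
open StructSet public

_⇔_ : Set → Set → Set
P ⇔ Q = (P → Q) × (Q → P)

data Quant : Set where
  ∃q ∀q : Quant

dual : Quant → Quant
dual ∃q = ∀q
dual ∀q = ∃q

Term : Schema → ℕ → Set
Term τ r = Fin r ⊎ Fin (nConst τ)

data Atom (τ : Schema) (r : ℕ) : Set where
  eqVV : (i j : Fin r) → i ≢ j → Atom τ r
  eqCV : (c : Fin (nConst τ)) (j : Fin r) → Atom τ r
  eqCC : (c d : Fin (nConst τ)) → c ≢ d → Atom τ r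
  relA : (R : Fin (nRel τ)) → (Fin (arity τ R) → Term τ r) → Atom τ r

-- A type over x₁ … x_r: for every atomic formula, exactly one of it
-- (true) or its negation (false) is a conjunct.
Type : Schema → ℕ → Set
Type τ r = Atom τ r → Bool

module _ {τ : Schema} (M : Structure τ) where

  evalT : ∀ {r} → Vec (Carrier M) r → Term τ r → Carrier M
  evalT v = [ lookup v , const M ]

  ⟦_⟧A : ∀ {r} → Atom τ r → Vec (Carrier M) r → Set
  ⟦ eqVV i j _ ⟧A v = lookup v i ≡ lookup v j
  ⟦ eqCV c j ⟧A v   = const M c ≡ lookup v j
  ⟦ eqCC c d _ ⟧A v = const M c ≡ const M d
  ⟦ relA R ts ⟧A v  = rel M R (λ k → evalT v (ts k))

  literal : Bool → Set → Set
  literal true  P = P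
  literal false P = ¬ P

  SatType : ∀ {r} → Type τ r → Vec (Carrier M) r → Set
  SatType t v = ∀ a → literal (t a) (⟦ a ⟧A v)

  -- Q₁ x₁ … Q_k x_k P  (x₁ is the outermost variable)
  quantify : ∀ {k} → Vec Quant k → (Vec (Carrier M) k → Set₁) → Set₁
  quantify []          P = P []
  quantify (∃q ∷ qs) P = Σ (Carrier M) λ a → quantify qs (λ v → P (a ∷ v))
  quantify (∀q ∷ qs) P = (a : Carrier M) → quantify qs (λ v → P (a ∷ v))

Consistent : ∀ {τ r} → Type τ r → Set₁
Consistent {τ} {r} t = Σ (Structure τ) λ M → Σ (Vec (Carrier M) r) λ v → SatType M t v

-- t "occurs as a disjunct" of θ (types compared as the same conjunction)
Occurs : ∀ {τ r} → Type τ r → List (Type τ r) → Set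
Occurs t θ = Any (λ u → ∀ a → u a ≡ t a) θ

-- A sentence in the normal form  Q₁x₁ … Q_r x_r θ,  θ a finite disjunction
-- of (consistent) types over x₁ … x_r.
record Sentence (τ : Schema) (r : ℕ) : Set₁ where
  field
    prefix     : Vec Quant r
    θ          : List (Type τ r)
    consistent : All Consistent θ
open Sentence public

-- A prenex "sentence" whose matrix is a disjunction of types given by a
-- predicate saying which types are disjuncts (used for both ψ and ¬ψ).
record PSentence (τ : Schema) (r : ℕ) : Set₂ where
  field
    pprefix   : Vec Quant r
    disjunct  : Type τ r → Set₁
open PSentence public

asP : ∀ {τ r} → Sentence τ r → PSentence τ r
asP ψ = record { pprefix = prefix ψ ; disjunct = λ t → Level.Lift _ (Occurs t (θ ψ)) }

-- ¬ψ = Q̄₁x₁ … Q̄_r x_r θ' , θ' the disjunction of the consistent types not in θ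
negS : ∀ {τ r} → Sentence τ r → PSentence τ r
negS ψ = record { pprefix = map dual (prefix ψ)
                ; disjunct = λ t → Consistent t × ¬ Occurs t (θ ψ) }

_⊨_ : ∀ {τ r} → Structure τ → PSentence τ r → Set₁
M ⊨ φ = quantify M (pprefix φ) (λ v → Σ _ λ t → disjunct φ t × SatType M t v)

NonReplicatingType : ∀ {τ r} → Vec Quant r → Type τ r → Set
NonReplicatingType {τ} {r} qs t =
  (∀ (i j : Fin r) (p : i ≢ j) → t (eqVV i j p) ≡ true →
       (lookup qs i ≡ ∀q × lookup qs j ≡ ∀q)
     ⊎ (lookup qs i ≡ ∃q × lookup qs j ≡ ∀q × toℕ i <ℕ toℕ j)
     ⊎ (lookup qs j ≡ ∃q × lookup qs i ≡ ∀q × toℕ j <ℕ toℕ i))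
  × (∀ (c : Fin (nConst τ)) (j : Fin r) → t (eqCV c j) ≡ true → lookup qs j ≡ ∀q)

NonReplicating : ∀ {τ r} → PSentence τ r → Set₁
NonReplicating φ = ∀ t → disjunct φ t → NonReplicatingType (pprefix φ) t

Separating : ∀ {τ r} → Sentence τ r → StructSet τ → StructSet τ → Set₁
Separating ψ 𝒜 ℬ = (∀ i → str 𝒜 i ⊨ asP ψ) × (∀ j → str ℬ j ⊨ negS ψ)

record Pebbled (τ : Schema) (t : ℕ) : Set₁ where
  field
    base    : Structure τ
    pebbles : Vec (Carrier base) t
open Pebbled public

record PSet (τ : Schema) (t : ℕ) : Set₁ where
  field
    Pos : Set
    at  : Pos → Pebbled τ t
open PSet public

point : ∀ {τ t} (P : Pebbled τ t) → Fin t ⊎ Fin (nConst τ) → Carrier (base P)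
point P = [ lookup (pebbles P) , const (base P) ]

-- the map a_i ↦ b_i, c^A ↦ c^B is a well-defined bijection between the
-- domains, preserving and reflecting all relations on them
MatchingPair : ∀ {τ t} → Pebbled τ t → Pebbled τ t → Set
MatchingPair {τ} {t} P Q =
    (∀ p q → (point P p ≡ point P q) ⇔ (point Q p ≡ point Q q))
  × (∀ (R : Fin (nRel τ)) (ts : Fin (arity τ R) → Fin t ⊎ Fin (nConst τ)) →
       rel (base P) R (λ k → point P (ts k)) ⇔ rel (base Q) R (λ k → point Q (ts k)))

NoMatchingPair : ∀ {τ t} → PSet τ t → PSet τ t → Set
NoMatchingPair L R = ∀ i j → ¬ MatchingPair (at L i) (at R j)

-- a pebble on a is "on top" if a carries a pebble or interprets a constant
NotOnTop : ∀ {τ t} (P : Pebbled τ t) → Carrier (base P) → Set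
NotOnTop P a = ∀ p → a ≢ point P p

place : ∀ {τ t} (P : Pebbled τ t) → Carrier (base P) → Pebbled τ (suc t)
place P a = record { base = base P ; pebbles = pebbles P ∷ʳ a }

SpoilerMove : ∀ {τ t} → PSet τ t → Set
SpoilerMove S = (i : Pos S) → Σ (Carrier (base (at S i))) (NotOnTop (at S i))

afterSpoiler : ∀ {τ t} (S : PSet τ t) → SpoilerMove S → PSet τ (suc t)
afterSpoiler S m = record { Pos = Pos S ; at = λ i → place (at S i) (Σ.proj₁ (m i)) }

-- Duplicator's reply on a side: any number of copies of each structure,
-- each with a pebble placed on some element
record DuplicatorMove {τ t} (S : PSet τ t) : Set₁ where
  field
    Copies : Set
    orig   : Copies → Pos S
    elt    : (c : Copies) → Carrier (base (at S (orig c)))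
open DuplicatorMove public

afterDuplicator : ∀ {τ t} (S : PSet τ t) → DuplicatorMove S → PSet τ (suc t)
afterDuplicator S d = record { Pos = Copies d ; at = λ c → place (at S (orig d c)) (elt d c) }

SpoilerWinsNoTop : ∀ {τ t} → ℕ → PSet τ t → PSet τ t → Set₁
SpoilerWinsNoTop zero    L R = Level.Lift (lsuc lzero) (NoMatchingPair L R)
SpoilerWinsNoTop (suc k) L R =
    Level.Lift (lsuc lzero) (NoMatchingPair L R)
  ⊎ (Σ (SpoilerMove L) λ m → (d : DuplicatorMove R) →
        SpoilerWinsNoTop k (afterSpoiler L m) (afterDuplicator R d))
  ⊎ (Σ (SpoilerMove R) λ m → (d : DuplicatorMove L) →
        SpoilerWinsNoTop k (afterDuplicator L d) (afterSpoiler R m))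

unpebbled : ∀ {τ} → StructSet τ → PSet τ 0
unpebbled 𝒜 = record { Pos = Idx 𝒜 ; at = λ i → record { base = str 𝒜 i ; pebbles = [] } }

SpoilerWinsMSNoTop : ∀ {τ} → ℕ → StructSet τ → StructSet τ → Set₁
SpoilerWinsMSNoTop r 𝒜 ℬ = SpoilerWinsNoTop r (unpebbled 𝒜) (unpebbled ℬ)

-- Spoiler plays the two sentences against each other: in round t + 1 he
-- places pebble t + 1 on the side where x_{t+1} is existential (the left for
-- an ∃ of ψ, the right for an ∃ of ¬ψ), in every structure there on a witness
-- for x_{t+1}.  Whatever Duplicator answers, every left structure still
-- satisfies the rest of ψ and every right one the rest of ¬ψ under its
-- pebbles; after r rounds a matching pair would realize the same type, once
-- as a disjunct of θ and once outside θ.  A witness is never placed on top: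
-- otherwise the type realized by a completed assignment would equate the
-- existential x_{t+1} with an earlier variable or a constant, which
-- non-replication forbids.
module Submission where

open import Defs
open import Level using (lift; lower)
open import Data.Nat using (ℕ; zero; suc; _+_)
open import Data.Nat as ℕ using ()
open import Data.Nat.Properties using (+-identityʳ; +-suc; m≤m+n; <-asym; module ≤-Reasoning)
open import Data.Fin as Fin using (Fin; toℕ; _↑ˡ_; _↑ʳ_; _<_)
open import Data.Fin.Properties using (toℕ<n; toℕ-↑ˡ; toℕ-↑ʳ; toℕ-cast; <⇒≢)
open import Data.Vec using (Vec; []; _∷_; lookup; _∷ʳ_; map; _++_; cast)
open import Data.Vec.Properties
  using ( lookup-map; lookup-cast; lookup-++ˡ; lookup-++ʳ
        ; cast-is-id; cast-trans; ∷ʳ-++-eqFree; ++-identityʳ-eqFree )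
open import Data.List.Relation.Unary.Any as Any using ()
open import Data.Product using (Σ; _×_; _,_; proj₁; proj₂)
open import Data.Sum using (inj₁; inj₂)
open import Data.Bool using (true; false)
open import Data.Empty using (⊥-elim)
open import Relation.Nullary using (¬_)
open import Relation.Binary.PropositionalEquality
  using (_≡_; _≢_; refl; sym; trans; cong; subst; subst₂; module ≡-Reasoning)

module _ {A : Set} where

  cast-∷ʳ-++ : ∀ {m n o} .(e : m + suc n ≡ o) .(e′ : suc m + n ≡ o)
    (xs : Vec A m) (a : A) (ys : Vec A n) →
    cast e′ ((xs ∷ʳ a) ++ ys) ≡ cast e (xs ++ (a ∷ ys))
  cast-∷ʳ-++ {m} {n} e e′ xs a ys = begin
    cast e′ ((xs ∷ʳ a) ++ ys)
      ≡⟨ sym (cast-trans (sym (+-suc m n)) e ((xs ∷ʳ a) ++ ys)) ⟩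
    cast e (cast (sym (+-suc m n)) ((xs ∷ʳ a) ++ ys))
      ≡⟨ cong (cast e) (∷ʳ-++-eqFree a xs) ⟩
    cast e (xs ++ (a ∷ ys))
      ∎
    where open ≡-Reasoning

  cast-++-[] : ∀ {m o} .(e : m + 0 ≡ o) .(e′ : m ≡ o) (xs : Vec A m) →
    cast e (xs ++ []) ≡ cast e′ xs
  cast-++-[] {m} e e′ xs = begin
    cast e (xs ++ [])
      ≡⟨ sym (cast-trans (+-identityʳ m) e′ (xs ++ [])) ⟩
    cast e′ (cast (+-identityʳ m) (xs ++ []))
      ≡⟨ cong (cast e′) (++-identityʳ-eqFree xs) ⟩
    cast e′ xs
      ∎
    where open ≡-Reasoning

  lookup-cast-↑ˡ : ∀ {m n o} .(e : m + n ≡ o) (xs : Vec A m) (ys : Vec A n) (i : Fin m) →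
    lookup (cast e (xs ++ ys)) (Fin.cast e (i ↑ˡ n)) ≡ lookup xs i
  lookup-cast-↑ˡ e xs ys i = trans (lookup-cast e (xs ++ ys) _) (lookup-++ˡ xs ys i)

  lookup-cast-↑ʳ : ∀ {m n o} .(e : m + n ≡ o) (xs : Vec A m) (ys : Vec A n) (j : Fin n) →
    lookup (cast e (xs ++ ys)) (Fin.cast e (m ↑ʳ j)) ≡ lookup ys j
  lookup-cast-↑ʳ e xs ys j = trans (lookup-cast e (xs ++ ys) _) (lookup-++ʳ xs ys j)

↑ˡ<↑ʳ : ∀ {m n} (i : Fin m) (j : Fin n) → i ↑ˡ n < m ↑ʳ j
↑ˡ<↑ʳ {m} {n} i j = begin-strict
  toℕ (i ↑ˡ n)  ≡⟨ toℕ-↑ˡ i n ⟩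
  toℕ i         <⟨ toℕ<n i ⟩
  m             ≤⟨ m≤m+n m (toℕ j) ⟩
  m + toℕ j     ≡⟨ sym (toℕ-↑ʳ m j) ⟩
  toℕ (m ↑ʳ j)  ∎
  where open ≤-Reasoning

cast-< : ∀ {m n} .(e : m ≡ n) {i j : Fin m} → i < j → Fin.cast e i < Fin.cast e j
cast-< e {i} {j} = subst₂ ℕ._<_ (sym (toℕ-cast e i)) (sym (toℕ-cast e j))

module _ {τ : Schema} {M : Structure τ} where

  quantify-mono : ∀ {k} (qs : Vec Quant k) {P Q : Vec (Carrier M) k → Set₁} →
    (∀ w → P w → Q w) → quantify M qs P → quantify M qs Q
  quantify-mono []         f h       = f [] h
  quantify-mono (∃q ∷ qs) f (a , h) = a , quantify-mono qs (λ w → f (a ∷ w)) h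
  quantify-mono (∀q ∷ qs) f h a     = quantify-mono qs (λ w → f (a ∷ w)) (h a)

  quantify-witness : ∀ {k} (qs : Vec Quant k) {P : Vec (Carrier M) k → Set₁} →
    Carrier M → quantify M qs P → Σ (Vec (Carrier M) k) P
  quantify-witness []         _ h       = [] , h
  quantify-witness (∃q ∷ qs) d (a , h) = let w , p = quantify-witness qs d h in a ∷ w , p
  quantify-witness (∀q ∷ qs) d h       = let w , p = quantify-witness qs d (h d) in d ∷ w , p

  literal-true : ∀ {b P} → literal M b P → P → b ≡ true
  literal-true {true}  _  _ = refl
  literal-true {false} ¬p p = ⊥-elim (¬p p)

literals-agree : ∀ {τ} {M N : Structure τ} {b b′ P Q} →
  literal M b P → literal N b′ Q → P ⇔ Q → b ≡ b′
literals-agree {b = true}  {true}  _  _   _         = refl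
literals-agree {b = false} {false} _  _   _         = refl
literals-agree {b = true}  {false} p  ¬q (p⇒q , _) = ⊥-elim (¬q (p⇒q p))
literals-agree {b = false} {true}  ¬p q  (_ , q⇒p) = ⊥-elim (¬p (q⇒p q))

module _ {τ : Schema} {t : ℕ} {P Q : Pebbled τ t} (mp : MatchingPair P Q) where

  matching-pair-atom : ∀ a → ⟦_⟧A (base P) a (pebbles P) ⇔ ⟦_⟧A (base Q) a (pebbles Q)
  matching-pair-atom (eqVV i j _) = proj₁ mp (inj₁ i) (inj₁ j)
  matching-pair-atom (eqCV c j)   = proj₁ mp (inj₂ c) (inj₁ j)
  matching-pair-atom (eqCC c d _) = proj₁ mp (inj₂ c) (inj₂ d)
  matching-pair-atom (relA R ts)  = proj₂ mp R ts

  matching-pair-same-type : ∀ {ty ty′} →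
    SatType (base P) ty (pebbles P) → SatType (base Q) ty′ (pebbles Q) → ∀ a → ty a ≡ ty′ a
  matching-pair-same-type sat sat′ a =
    literals-agree {M = base P} {base Q} (sat a) (sat′ a) (matching-pair-atom a)

∃q≢∀q : ∃q ≢ ∀q
∃q≢∀q ()

module _ {τ : Schema} {r : ℕ} (qs : Vec Quant r) (ty : Type τ r) (nr : NonReplicatingType qs ty)
         {x : Fin r} (x∃ : lookup qs x ≡ ∃q) where

  existential-≢-earlier : ∀ y (y≢x : y ≢ x) → y < x → ty (eqVV y x y≢x) ≢ true
  existential-≢-earlier y y≢x y<x eq with proj₁ nr y x y≢x eq
  ... | inj₁ (_ , x∀)               = ∃q≢∀q (trans (sym x∃) x∀)
  ... | inj₂ (inj₁ (_ , x∀ , _))    = ∃q≢∀q (trans (sym x∃) x∀)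
  ... | inj₂ (inj₂ (_ , _ , x<y))   = <-asym x<y y<x

  existential-≢-constant : ∀ c → ty (eqCV c x) ≢ true
  existential-≢-constant c eq = ∃q≢∀q (trans (sym x∃) (proj₂ nr c x eq))

module _ {τ : Schema} {r : ℕ} where

  Matrix : PSentence τ r → (M : Structure τ) → Vec (Carrier M) r → Set₁
  Matrix φ M v = Σ (Type τ r) λ ty → disjunct φ ty × SatType M ty v

  -- The pebbles of P assign x₁ … x_t, and qs quantifies x_{t+1} … x_r.
  Remaining : PSentence τ r → ∀ {t k} → Vec Quant k → t + k ≡ r → Pebbled τ t → Set₁
  Remaining φ qs e P = quantify (base P) qs (λ w → Matrix φ (base P) (cast e (pebbles P ++ w)))

  shift : ∀ {t k} → t + suc k ≡ r → suc t + k ≡ r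
  shift {t} {k} e = trans (sym (+-suc t k)) e

  advance : ∀ φ {t k} (qs : Vec Quant k) (P : Pebbled τ t) (a : Carrier (base P))
    (e : t + suc k ≡ r) →
    quantify (base P) qs (λ w → Matrix φ (base P) (cast e (pebbles P ++ (a ∷ w)))) →
    Remaining φ qs (shift e) (place P a)
  advance φ qs P a e = quantify-mono qs λ w →
    subst (Matrix φ (base P)) (sym (cast-∷ʳ-++ e (shift e) (pebbles P) a w))

  witness-not-on-top : ∀ φ {t k} (qs : Vec Quant k) → NonReplicating φ →
    (P : Pebbled τ t) (a : Carrier (base P)) (e : t + suc k ≡ r) →
    lookup (pprefix φ) (Fin.cast e (t ↑ʳ Fin.zero)) ≡ ∃q →
    quantify (base P) qs (λ w → Matrix φ (base P) (cast e (pebbles P ++ (a ∷ w)))) →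
    NotOnTop P a
  -- Complete the assignment (using a for the universal variables) and inspect its type.
  witness-not-on-top φ {t} {k} qs nr P a e x∃ h with quantify-witness qs a h
  ... | w , ty , d , sat = on-top-impossible
    where
    x : Fin r
    x = Fin.cast e (t ↑ʳ Fin.zero)
    a-at-x : lookup (cast e (pebbles P ++ (a ∷ w))) x ≡ a
    a-at-x = lookup-cast-↑ʳ e (pebbles P) (a ∷ w) Fin.zero
    on-top-impossible : NotOnTop P a
    on-top-impossible (inj₂ c) a≡c =
      existential-≢-constant (pprefix φ) ty (nr ty d) x∃ c
        (literal-true {M = base P} (sat (eqCV c x)) (sym (trans a-at-x a≡c)))
    on-top-impossible (inj₁ i) a≡pᵢ =
      existential-≢-earlier (pprefix φ) ty (nr ty d) x∃ y (<⇒≢ y<x) y<x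
        (literal-true {M = base P} (sat (eqVV y x (<⇒≢ y<x)))
          (trans (lookup-cast-↑ˡ e (pebbles P) (a ∷ w) i) (sym (trans a-at-x a≡pᵢ))))
      where
      y : Fin r
      y = Fin.cast e (i ↑ˡ suc k)
      y<x : y < x
      y<x = cast-< e (↑ˡ<↑ʳ i Fin.zero)

  module _ (φL φR : PSentence τ r) (nrL : NonReplicating φL) (nrR : NonReplicating φR)
           (dual-prefix : pprefix φR ≡ map dual (pprefix φL))
           (no-common-disjunct : ∀ {ty ty′} → disjunct φL ty → disjunct φR ty′ →
                                  ¬ (∀ a → ty a ≡ ty′ a)) where

    quantifier-at : ∀ {t k} (ps : Vec Quant t) (q : Quant) (qs : Vec Quant k) (e : t + suc k ≡ r) →
      cast e (ps ++ (q ∷ qs)) ≡ pprefix φL →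
      lookup (pprefix φL) (Fin.cast e (t ↑ʳ Fin.zero)) ≡ q
    quantifier-at ps q qs e pre≡ =
      trans (cong (λ pre → lookup pre _) (sym pre≡)) (lookup-cast-↑ʳ e ps (q ∷ qs) Fin.zero)

    dual-quantifier-at : ∀ {t k} (ps : Vec Quant t) (q : Quant) (qs : Vec Quant k) (e : t + suc k ≡ r) →
      cast e (ps ++ (q ∷ qs)) ≡ pprefix φL →
      lookup (pprefix φR) (Fin.cast e (t ↑ʳ Fin.zero)) ≡ dual q
    dual-quantifier-at ps q qs e pre≡ = begin
      lookup (pprefix φR) x              ≡⟨ cong (λ pre → lookup pre x) dual-prefix ⟩
      lookup (map dual (pprefix φL)) x   ≡⟨ lookup-map x dual (pprefix φL) ⟩
      dual (lookup (pprefix φL) x)       ≡⟨ cong dual (quantifier-at ps q qs e pre≡) ⟩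
      dual q                             ∎
      where
      open ≡-Reasoning
      x = Fin.cast e (_ ↑ʳ Fin.zero)

    no-matching-pair : ∀ {t} (e : t ≡ r) (P Q : Pebbled τ t) →
      Matrix φL (base P) (cast e (pebbles P)) → Matrix φR (base Q) (cast e (pebbles Q)) →
      ¬ MatchingPair P Q
    no-matching-pair refl P Q (ty , d , sat) (ty′ , d′ , sat′) mp =
      no-common-disjunct d d′
        (matching-pair-same-type mp (uncast (base P) sat) (uncast (base Q) sat′))
      where
      uncast : ∀ M {ty} {v : Vec (Carrier M) r} → SatType M ty (cast refl v) → SatType M ty v
      uncast M {ty} = subst (SatType M ty) (cast-is-id refl _)

    spoiler-wins : ∀ k {t} (ps : Vec Quant t) (qs : Vec Quant k) (e : t + k ≡ r) →
      cast e (ps ++ qs) ≡ pprefix φL → (L R : PSet τ t) →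
      (∀ i → Remaining φL qs e (at L i)) → (∀ j → Remaining φR (map dual qs) e (at R j)) →
      SpoilerWinsNoTop k L R
    spoiler-wins zero {t} ps [] e _ L R hL hR = lift λ i j →
      no-matching-pair e₀ (at L i) (at R j)
        (subst (Matrix φL _) (cast-++-[] e e₀ _) (hL i))
        (subst (Matrix φR _) (cast-++-[] e e₀ _) (hR j))
      where
      e₀ : t ≡ r
      e₀ = trans (sym (+-identityʳ t)) e
    spoiler-wins (suc k) ps (∃q ∷ qs) e pre≡ L R hL hR = inj₂ (inj₁ (move , λ d →
      spoiler-wins k (ps ∷ʳ ∃q) qs (shift e) (trans (cast-∷ʳ-++ e (shift e) ps ∃q qs) pre≡)
        (afterSpoiler L move) (afterDuplicator R d)
        (λ i → advance φL qs (at L i) (proj₁ (hL i)) e (proj₂ (hL i)))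
        (λ c → advance φR (map dual qs) (at R (orig d c)) (elt d c) e (hR (orig d c) (elt d c)))))
      where
      move : SpoilerMove L
      move i = proj₁ (hL i) , witness-not-on-top φL qs nrL (at L i) (proj₁ (hL i)) e
                                 (quantifier-at ps ∃q qs e pre≡) (proj₂ (hL i))
    spoiler-wins (suc k) ps (∀q ∷ qs) e pre≡ L R hL hR = inj₂ (inj₂ (move , λ d →
      spoiler-wins k (ps ∷ʳ ∀q) qs (shift e) (trans (cast-∷ʳ-++ e (shift e) ps ∀q qs) pre≡)
        (afterDuplicator L d) (afterSpoiler R move)
        (λ c → advance φL qs (at L (orig d c)) (elt d c) e (hL (orig d c) (elt d c)))
        (λ j → advance φR (map dual qs) (at R j) (proj₁ (hR j)) e (proj₂ (hR j)))))
      where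
      move : SpoilerMove R
      move j = proj₁ (hR j) , witness-not-on-top φR (map dual qs) nrR (at R j) (proj₁ (hR j)) e
                                 (dual-quantifier-at ps ∀q qs e pre≡) (proj₂ (hR j))

    spoiler-wins-MS : {𝒜 ℬ : StructSet τ} → (∀ i → str 𝒜 i ⊨ φL) → (∀ j → str ℬ j ⊨ φR) →
      SpoilerWinsMSNoTop r 𝒜 ℬ
    spoiler-wins-MS {𝒜} {ℬ} ⊨L ⊨R =
      spoiler-wins r [] (pprefix φL) refl (cast-is-id refl _) (unpebbled 𝒜) (unpebbled ℬ)
        (λ i → start φL (pprefix φL) (⊨L i))
        (λ j → start φR (map dual (pprefix φL))
                 (subst (λ qs → quantify (str ℬ j) qs _) dual-prefix (⊨R j)))
      where
      start : ∀ φ (qs : Vec Quant r) {M} →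
        quantify M qs (Matrix φ M) → quantify M qs (λ w → Matrix φ M (cast refl w))
      start φ qs {M} = quantify-mono qs λ w → subst (Matrix φ M) (sym (cast-is-id refl w))

ψ-¬ψ-no-common-disjunct : ∀ {τ r} (ψ : Sentence τ r) {ty ty′} →
  disjunct (asP ψ) ty → disjunct (negS ψ) ty′ → ¬ (∀ a → ty a ≡ ty′ a)
ψ-¬ψ-no-common-disjunct ψ ty∈θ (_ , ty′∉θ) ty≗ty′ =
  ty′∉θ (Any.map (λ u≗ty a → trans (u≗ty a) (ty≗ty′ a)) (lower ty∈θ))

corollary4p7 : (τ : Schema) (r : ℕ) (𝒜 ℬ : StructSet τ) (ψ : Sentence τ r) →
    Separating ψ 𝒜 ℬ → NonReplicating (asP ψ) → NonReplicating (negS ψ) →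
    SpoilerWinsMSNoTop r 𝒜 ℬ
corollary4p7 τ r 𝒜 ℬ ψ (ψ-on-𝒜 , ¬ψ-on-ℬ) nrL nrR =
  spoiler-wins-MS (asP ψ) (negS ψ) nrL nrR refl (ψ-¬ψ-no-common-disjunct ψ) ψ-on-𝒜 ¬ψ-on-ℬ
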